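{- Consider the modified connectivity query obtained from the query \texttt{connected(u, v)} described in the context by omitting its last root search and re-check (the final ``if $\texttt{find\_root}(u) \neq (r_u, V_u)$, restart'' executed in the case $r_u \neq r_v$). Then the modified query is not linearizable: there is an execution with one reader and the single writer in which the modified \texttt{connected(u, v)} returns \texttt{false} although $u$ and $v$ were in the same connected component at every moment during the invocation.
   Context: Shared-memory model with asynchronous threads; single-word reads and writes are atomic. A forest is stored as a collection of nodes, each with a \texttt{parent} pointer (\texttt{null} iff root) and an integer \texttt{version}; the connected components are the sets of nodes reaching the same root by parent pointers. Only a single writer thread performs modifications (edge additions/removals), one at a time; each modification, before doing anything else, increments the \texttt{version} of every node that is a root of an affected component before the modification or becomes such a root by it, and its logical merge/split takes effect at a single write of one parent pointer. Readers use \texttt{find\_root(w)}: starting at $w$, follow parent pointers until a node whose \texttt{parent} is \texttt{null} is read, then return that node with its current \texttt{version} (read afterwards). The query \texttt{connected(u, v)} loops: $(r_u, V_u) := \texttt{find\_root}(u)$; $(r_v, V_v) := \texttt{find\_root}(v)$; if $\texttt{find\_root}(u) \neq (r_u, V_u)$ restart; if $r_u \neq r_v$: if $\texttt{find\_root}(v) \neq (r_v, V_v)$ restart, then if $\texttt{find\_root}(u) \neq (r_u, V_u)$ restart; return whether $r_u = r_v$. -}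

module Defs where

open import Data.Nat using (ℕ; suc)
open import Data.Fin using (Fin) renaming (_≟_ to _≟ᶠ_)
open import Data.Nat using () renaming (_≟_ to _≟ⁿ_)
open import Data.Maybe using (Maybe; just; nothing)
open import Data.Bool using (Bool; true; false; if_then_else_)
open import Data.List using (List; []; _∷_; _++_; map; concatMap; take; drop)
open import Data.List.Relation.Unary.All using (All)
open import Data.List.Membership.Propositional using (_∈_)
open import Data.Product using (Σ; _×_; _,_; ∃)
open import Data.Sum using (_⊎_)
open import Data.Unit using (⊤)
open import Relation.Nullary using (¬_)
open import Relation.Nullary.Decidable using (⌊_⌋)
open import Relation.Binary.PropositionalEquality using (_≡_)
open import Function.Bundles using (_⇔_)

record Mem (n : ℕ) : Set where
  field
    parent  : Fin n → Maybe (Fin n)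
    version : Fin n → ℕ
open Mem public

IsRoot : ∀ {n} → Mem n → Fin n → Set
IsRoot M r = parent M r ≡ nothing

data Reaches {n} (M : Mem n) : Fin n → Fin n → Set where
  here  : ∀ {x} → Reaches M x x
  there : ∀ {x y z} → parent M x ≡ just y → Reaches M y z → Reaches M x z

RootOf : ∀ {n} → Mem n → Fin n → Fin n → Set
RootOf M x r = IsRoot M r × Reaches M x r

Forest : ∀ {n} → Mem n → Set
Forest {n} M = ∀ (x : Fin n) → ∃ λ r → RootOf M x r

Connected : ∀ {n} → Mem n → Fin n → Fin n → Set
Connected M x y = ∃ λ r → RootOf M x r × RootOf M y r

SamePartition : ∀ {n} → Mem n → Mem n → Set
SamePartition {n} A B = ∀ (x y : Fin n) → Connected A x y ⇔ Connected B x y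

MergeOf : ∀ {n} → Mem n → Mem n → Set
MergeOf {n} A B = Σ (Fin n) λ a → Σ (Fin n) λ b → ¬ Connected A a b ×
  (∀ (x y : Fin n) → Connected B x y ⇔
     (Connected A x y ⊎ (Connected A x a × Connected A y b) ⊎ (Connected A x b × Connected A y a)))

SplitOf : ∀ {n} → Mem n → Mem n → Set
SplitOf A B = MergeOf B A

Affected : ∀ {n} → Mem n → Mem n → Fin n → Set
Affected {n} A B r = ¬ (∀ (x : Fin n) → Connected A x r ⇔ Connected B x r)

setParent : ∀ {n} → Fin n → Maybe (Fin n) → Mem n → Mem n
setParent x m M = record M { parent = λ y → if ⌊ y ≟ᶠ x ⌋ then m else parent M y }

incVersion : ∀ {n} → Fin n → Mem n → Mem n
incVersion x M = record M { version = λ y → if ⌊ y ≟ᶠ x ⌋ then suc (version M y) else version M y }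

data Write (n : ℕ) : Set where
  incV : Fin n → Write n
  setP : Fin n → Maybe (Fin n) → Write n

applyW : ∀ {n} → Write n → Mem n → Mem n
applyW (incV x)   M = incVersion x M
applyW (setP x m) M = setParent x m M

applyWs : ∀ {n} → List (Write n) → Mem n → Mem n
applyWs []       M = M
applyWs (w ∷ ws) M = applyWs ws (applyW w M)

statesOf : ∀ {n} → Mem n → List (Write n) → List (Mem n)
statesOf M []       = M ∷ []
statesOf M (w ∷ ws) = M ∷ statesOf (applyW w M) ws

record Mod (n : ℕ) : Set where
  field
    bumps  : List (Fin n)
    pwrites : List (Fin n × Maybe (Fin n))
open Mod public

toSetP : ∀ {n} → Fin n × Maybe (Fin n) → Write n
toSetP (x , m) = setP x m

writesOfMod : ∀ {n} → Mod n → List (Write n)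
writesOfMod m = map incV (bumps m) ++ map toSetP (pwrites m)

writesOfMods : ∀ {n} → List (Mod n) → List (Write n)
writesOfMods = concatMap writesOfMod

AllSame : ∀ {n} → List (Mem n) → Set
AllSame []            = ⊤
AllSame (x ∷ [])      = ⊤
AllSame (x ∷ y ∷ ys)  = SamePartition x y × AllSame (y ∷ ys)

-- the partition changes at (at most) one single write
AtMostOneChange : ∀ {n} → List (Mem n) → Set
AtMostOneChange []           = ⊤
AtMostOneChange (x ∷ [])     = ⊤
AtMostOneChange (x ∷ y ∷ ys) = (SamePartition x y × AtMostOneChange (y ∷ ys)) ⊎ AllSame (y ∷ ys)

ValidMod : ∀ {n} → Mem n → Mod n → Set
ValidMod {n} M m =
  let Mb    = applyWs (map incV (bumps m)) M
      sts   = statesOf Mb (map toSetP (pwrites m))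
      Mend  = applyWs (writesOfMod m) M
  in All Forest sts
   × AtMostOneChange sts
   × (SamePartition M Mend ⊎ MergeOf M Mend ⊎ SplitOf M Mend)
   × (∀ (r : Fin n) → (IsRoot M r × Affected M Mend r) ⊎ (IsRoot Mend r × Affected M Mend r)
                    → r ∈ bumps m)

ValidMods : ∀ {n} → Mem n → List (Mod n) → Set
ValidMods M []       = ⊤
ValidMods M (m ∷ ms) = ValidMod M m × ValidMods (applyWs (writesOfMod m) M) ms

-- The reader: find_root as a step machine, one atomic read per step.

data FR (n : ℕ) : Set where
  walk   : Fin n → FR n
  atRoot : Fin n → FR n

frStep : ∀ {n} → Mem n → FR n → FR n ⊎ (Fin n × ℕ)
frStep M (walk x) with parent M x
... | nothing = _⊎_.inj₁ (atRoot x)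
... | just p  = _⊎_.inj₁ (walk p)
frStep M (atRoot r) = _⊎_.inj₂ (r , version M r)

-- reader states of the MODIFIED connected(u, v):
--   (ru,Vu) := find_root(u); (rv,Vv) := find_root(v);
--   if find_root(u) ≠ (ru,Vu) restart;
--   if ru ≠ rv: if find_root(v) ≠ (rv,Vv) restart;
--   return ru = rv
data RState (n : ℕ) : Set where
  s1   : FR n → RState n
  s2   : Fin n → ℕ → FR n → RState n
  s3   : Fin n → ℕ → Fin n → ℕ → FR n → RState n
  s4   : Fin n → ℕ → Fin n → ℕ → FR n → RState n
  done : Bool → RState n

readerInit : ∀ {n} → Fin n → RState n
readerInit u = s1 (walk u)

sameRV : ∀ {n} → Fin n → ℕ → Fin n → ℕ → Bool
sameRV r V r' V' = if ⌊ r ≟ᶠ r' ⌋ then ⌊ V ≟ⁿ V' ⌋ else false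

readerStep : ∀ {n} → Fin n → Fin n → Mem n → RState n → RState n
readerStep u v M (s1 f) with frStep M f
... | _⊎_.inj₁ f'      = s1 f'
... | _⊎_.inj₂ (r , V) = s2 r V (walk v)
readerStep u v M (s2 ru Vu f) with frStep M f
... | _⊎_.inj₁ f'      = s2 ru Vu f'
... | _⊎_.inj₂ (r , V) = s3 ru Vu r V (walk u)
readerStep u v M (s3 ru Vu rv Vv f) with frStep M f
... | _⊎_.inj₁ f'      = s3 ru Vu rv Vv f'
... | _⊎_.inj₂ (r , V) =
  if sameRV r V ru Vu
  then (if ⌊ ru ≟ᶠ rv ⌋ then done true else s4 ru Vu rv Vv (walk v))
  else s1 (walk u)
readerStep u v M (s4 ru Vu rv Vv f) with frStep M f
... | _⊎_.inj₁ f'      = s4 ru Vu rv Vv f'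
... | _⊎_.inj₂ (r , V) =
  if sameRV r V rv Vv
  then done ⌊ ru ≟ᶠ rv ⌋
  else s1 (walk u)
readerStep u v M (done b) = done b

data Ev : Set where
  rd : Ev
  wr : Ev

record Config (n : ℕ) : Set where
  constructor cfg
  field
    mem     : Mem n
    rstate  : RState n
    pending : List (Write n)
open Config public

evStep : ∀ {n} → Fin n → Fin n → Config n → Ev → Config n
evStep u v (cfg M s ws)       rd = cfg M (readerStep u v M s) ws
evStep u v (cfg M s [])       wr = cfg M s []
evStep u v (cfg M s (w ∷ ws)) wr = cfg (applyW w M) s ws

trace : ∀ {n} → Fin n → Fin n → Config n → List Ev → List (Config n)
trace u v c []       = c ∷ []
trace u v c (e ∷ es) = c ∷ trace u v (evStep u v c e) es

finalCfg : ∀ {n} → Fin n → Fin n → Config n → List Ev → Config n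
finalCfg u v c []       = c
finalCfg u v c (e ∷ es) = finalCfg u v (evStep u v c e) es

data WellSched {n} (u v : Fin n) : Config n → List Ev → Set where
  nil  : ∀ {c} → WellSched u v c []
  cRd  : ∀ {c es} → WellSched u v (evStep u v c rd) es → WellSched u v c (rd ∷ es)
  cWr  : ∀ {M s w ws es} → WellSched u v (cfg (applyW w M) s ws) es
       → WellSched u v (cfg M s (w ∷ ws)) (wr ∷ es)

record BadExecution (n : ℕ) : Set where
  field
    M0    : Mem n
    u v   : Fin n
    mods  : List (Mod n)
    k     : ℕ
    sched : List Ev
    forest0 : Forest M0
    valid   : ValidMods M0 mods
  startCfg : Config n
  startCfg = cfg (applyWs (take k (writesOfMods mods)) M0) (readerInit u) (drop k (writesOfMods mods))
  field
    preOK     : k Data.Nat.≤ Data.List.length (writesOfMods mods)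
    wellSched : WellSched u v startCfg sched
    returnsFalse : rstate (finalCfg u v startCfg sched) ≡ done false
    alwaysConnected : All (λ c → Connected (mem c) u v) (trace u v startCfg sched)

{-# OPTIONS --safe #-}
module Submission where

-- The reader's find_root(v) passes through a node x just before x is cut out of
-- the common tree, then reads x's version after the writer has already bumped it
-- for the next merge, which will hang the old root r of u under x.  In between the
-- re-check of u still sees (r, V_u) unchanged and the re-check of v, after the
-- merge, sees (x, V_v) unchanged, so both re-checks pass with r ≠ x although u and
-- v were connected throughout.  Only the omitted second re-check of u, which would
-- now find root x, detects the interference.

open import Defs
open import Data.Nat using (ℕ; zero; suc; z≤n; s≤s)
open import Data.Fin as Fin using (Fin; _≟_)
open import Data.Fin.Properties using (all?; any?)
open import Data.Maybe as Maybe using (Maybe; just; nothing; _>>=_; from-just)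
open import Data.Maybe.Properties using (just-injective; ≡-dec)
open import Data.List using (List; []; _∷_; _++_; map; lookup; replicate; take; drop)
open import Data.List.Relation.Unary.All using (All; []; _∷_)
import Data.List.Membership.DecPropositional as Membership
open import Data.Product using (Σ; ∃; _,_)
open import Data.Unit using (tt)
open import Function.Bundles using (_⇔_; mk⇔; Equivalence)
open import Relation.Nullary using (Dec; yes; ¬?; contradiction)
open import Relation.Nullary.Decidable
  using (map′; dec⇒maybe; _×-dec_; _⊎-dec_; _→-dec_)
open import Relation.Binary.PropositionalEquality using (_≡_; refl; sym; trans)

private
  variable
    n : ℕ

_⇔-dec_ : {A B : Set} → Dec A → Dec B → Dec (A ⇔ B)
a? ⇔-dec b? = map′ (λ (f , g) → mk⇔ f g) (λ e → Equivalence.to e , Equivalence.from e)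
                   ((a? →-dec b?) ×-dec (b? →-dec a?))

all-just : {A : Set} {P : A → Set} → (∀ a → Maybe (P a)) → ∀ as → Maybe (All P as)
all-just f []       = just []
all-just f (a ∷ as) = f a >>= λ pa → all-just f as >>= λ pas → just (pa ∷ pas)

∀-just : {P : Fin n → Set} → (∀ i → Maybe (P i)) → Maybe (∀ i → P i)
∀-just {zero}  f = just λ ()
∀-just {suc n} f = f Fin.zero >>= λ p₀ → ∀-just (λ i → f (Fin.suc i)) >>= λ ps →
  just λ { Fin.zero → p₀ ; (Fin.suc i) → ps i }

root-unique : ∀ {M : Mem n} {x r r′} → IsRoot M r → Reaches M x r → IsRoot M r′ → Reaches M x r′ → r ≡ r′
root-unique _      here            _       here              = refl
root-unique r-root here            _       (there e _)       = contradiction (trans (sym r-root) e) λ ()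
root-unique _      (there e _)     r′-root here              = contradiction (trans (sym r′-root) e) λ ()
root-unique ρ      (there e reach) ρ′      (there e′ reach′) with just-injective (trans (sym e) e′)
... | refl = root-unique ρ reach ρ′ reach′

isRoot? : (M : Mem n) → ∀ r → Dec (IsRoot M r)
isRoot? M r = ≡-dec _≟_ (parent M r) nothing

rootWithin : ℕ → (M : Mem n) (x : Fin n) → Maybe (∃ (RootOf M x))
rootWithin zero    M x = nothing
rootWithin (suc k) M x with parent M x in eq
... | nothing = just (x , eq , here)
... | just y  = rootWithin k M y >>= λ (r , ρ , reach) → just (r , ρ , there eq reach)

-- Roots are reached in fewer than n steps in a forest on n nodes; on other
-- memories the search may fail, so forest? is only a sound certificate checker.
forest? : (M : Mem n) → Maybe (Forest M)
forest? {n} M = ∀-just (rootWithin n M)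

module _ {M : Mem n} (F : Forest M) where

  connected? : ∀ x y → Dec (Connected M x y)
  connected? x y with F x | F y
  ... | rx , ρx , x↝rx | ry , ρy , y↝ry = map′
    (λ { refl → rx , (ρx , x↝rx) , (ρy , y↝ry) })
    (λ { (r , (ρ , x↝r) , (ρ′ , y↝r)) → trans (root-unique ρx x↝rx ρ x↝r) (sym (root-unique ρy y↝ry ρ′ y↝r)) })
    (rx ≟ ry)

module _ {A B : Mem n} (FA : Forest A) (FB : Forest B) where

  samePartition? : Dec (SamePartition A B)
  samePartition? = all? λ x → all? λ y → connected? FA x y ⇔-dec connected? FB x y

  mergeOf? : Dec (MergeOf A B)
  mergeOf? = any? λ a → any? λ b → ¬? (connected? FA a b) ×-dec (all? λ x → all? λ y →
    connected? FB x y ⇔-dec (connected? FA x y ⊎-dec (connected? FA x a ×-dec connected? FA y b)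
                                                ⊎-dec (connected? FA x b ×-dec connected? FA y a)))

  affected? : ∀ r → Dec (Affected A B r)
  affected? r = ¬? (all? λ x → connected? FA x r ⇔-dec connected? FB x r)

allSame? : ∀ {Ms : List (Mem n)} → All Forest Ms → Dec (AllSame Ms)
allSame? []           = yes tt
allSame? (_ ∷ [])     = yes tt
allSame? (F ∷ G ∷ Fs) = samePartition? F G ×-dec allSame? (G ∷ Fs)

atMostOneChange? : ∀ {Ms : List (Mem n)} → All Forest Ms → Dec (AtMostOneChange Ms)
atMostOneChange? []           = yes tt
atMostOneChange? (_ ∷ [])     = yes tt
atMostOneChange? (F ∷ G ∷ Fs) = (samePartition? F G ×-dec atMostOneChange? (G ∷ Fs)) ⊎-dec allSame? (G ∷ Fs)

validMod? : (M : Mem n) (m : Mod n) → Maybe (ValidMod M m)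
validMod? M m = do
  FM     ← forest? M
  Fend   ← forest? Mend
  Fsteps ← all-just forest? steps
  rest   ← dec⇒maybe (atMostOneChange? Fsteps
                       ×-dec (samePartition? FM Fend ⊎-dec mergeOf? FM Fend ⊎-dec mergeOf? Fend FM)
                       ×-dec all? λ r →
                         ((isRoot? M r ×-dec affected? FM Fend r) ⊎-dec (isRoot? Mend r ×-dec affected? FM Fend r))
                         →-dec Membership._∈?_ _≟_ r (bumps m))
  just (Fsteps , rest)
  where
  Mend  = applyWs (writesOfMod m) M
  steps = statesOf (applyWs (map incV (bumps m)) M) (map toSetP (pwrites m))

validMods? : (M : Mem n) (ms : List (Mod n)) → Maybe (ValidMods M ms)
validMods? M []       = just tt
validMods? M (m ∷ ms) = do
  valid  ← validMod? M m
  valids ← validMods? (applyWs (writesOfMod m) M) ms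
  just (valid , valids)

module _ (u v : Fin n) where

  wellScheduled? : ∀ c es → Maybe (WellSched u v c es)
  wellScheduled? c                  []        = just nil
  wellScheduled? c                  (rd ∷ es) = Maybe.map cRd (wellScheduled? (evStep u v c rd) es)
  wellScheduled? (cfg M s [])       (wr ∷ es) = nothing
  wellScheduled? (cfg M s (w ∷ ws)) (wr ∷ es) = Maybe.map cWr (wellScheduled? (cfg (applyW w M) s ws) es)

  connectedThroughout? : (cs : List (Config n)) → Maybe (All (λ c → Connected (mem c) u v) cs)
  connectedThroughout? = all-just λ c → forest? (mem c) >>= λ F → dec⇒maybe (connected? F u v)

r u v x : Fin 4
r = Fin.zero
u = Fin.suc Fin.zero
v = Fin.suc (Fin.suc Fin.zero)
x = Fin.suc (Fin.suc (Fin.suc Fin.zero))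

initial : Mem 4
initial = record { parent = lookup (nothing ∷ just r ∷ just x ∷ just r ∷ []) ; version = λ _ → 0 }

detach-x : Mod 4
detach-x = record { bumps = r ∷ x ∷ [] ; pwrites = (v , just r) ∷ (x , nothing) ∷ [] }

reattach-r : Mod 4
reattach-r = record { bumps = x ∷ r ∷ [] ; pwrites = (r , just x) ∷ [] }

modifications : List (Mod 4)
modifications = detach-x ∷ reattach-r ∷ []

schedule : List Ev
schedule = replicate 4 rd      -- (r_u, V_u) = (r, 1); the reader has stepped from v to x
        ++ replicate 2 wr      -- v moves under r, x is cut off
        ++ rd ∷ wr ∷ rd ∷ []   -- x is a root; reattach-r bumps x; (r_v, V_v) = (x, 2)
        ++ replicate 3 rd      -- the re-check of u sees (r, 1) again
        ++ replicate 2 wr      -- r is bumped and hung under x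
        ++ replicate 4 rd      -- the re-check of v sees (x, 2) again, so r ≠ x is returned

-- The version bumps of detach-x happen before the invocation.
start : Config 4
start = cfg (applyWs (take 2 (writesOfMods modifications)) initial) (readerInit u)
            (drop 2 (writesOfMods modifications))

theorem4 : Σ ℕ λ n → BadExecution n
theorem4 = 4 , record
  { M0              = initial
  ; u               = u
  ; v               = v
  ; mods            = modifications
  ; k               = 2
  ; sched           = schedule
  ; forest0         = from-just (forest? initial)
  ; valid           = from-just (validMods? initial modifications)
  ; preOK           = s≤s (s≤s z≤n)
  ; wellSched       = from-just (wellScheduled? u v start schedule)
  ; returnsFalse    = refl
  ; alwaysConnected = from-just (connectedThroughout? u v (trace u v start schedule))
  }
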